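{- Every initial-loss non-tracking binary string is a concatenation of strings each of which is one of the four basic strings $0$, $001$, $0011$, $00101$.
   Context: Binary strings model radar observations: $1$ is a detection, $0$ a non-detection. A binary string $s = s_1 s_2 \cdots s_k$ ($k \ge 1$) produces a track (under the rule "3 out of 5 with loss 2") if there exist indices $i < j < l$ with $s_i = s_j = s_l = 1$, $l - i \le 4$, and no two consecutive zeros occurring among the positions strictly between $i$ and $l$. A string is non-tracking if it does not produce a track. An initial-loss non-tracking string is a non-tracking string of length $k\ge 1$ having no $1$ in its first or second position (i.e. $s_1 = 0$, and $s_2 = 0$ if $k \ge 2$). -}

module Defs where

open import Data.Bool using (Bool; true; false)
open import Data.Nat using (ℕ; zero; suc; _+_; _∸_; _<_; _≤_)
open import Data.List using (List; []; _∷_; concat)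
open import Data.List.Relation.Unary.All using (All)
open import Data.Product using (∃-syntax; _×_)
open import Relation.Binary.PropositionalEquality using (_≡_)
open import Relation.Nullary using (¬_)

-- A binary string: true = 1 (detection), false = 0 (non-detection).
BinStr : Set
BinStr = List Bool

-- 0-based position lookup; out-of-range positions read as 0 (false).
-- (Only used at in-range positions in the definitions below.)
at : BinStr → ℕ → Bool
at []       _       = false
at (b ∷ _)  zero    = b
at (_ ∷ bs) (suc n) = at bs n

-- s produces a track ("3 out of 5 with loss 2"), 0-based indices:
-- i < j < l, all detections, l - i ≤ 4, and no two consecutive zeros
-- at positions p, p+1 with i < p and p + 1 < l.
ProducesTrack : BinStr → Set
ProducesTrack s =
  ∃[ i ] ∃[ j ] ∃[ l ]
    (i < j × j < l × at s i ≡ true × at s j ≡ true × at s l ≡ true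
     × l ∸ i ≤ 4
     × (∀ p → i < p → suc p < l → ¬ (at s p ≡ false × at s (suc p) ≡ false)))

NonTracking : BinStr → Set
NonTracking s = ¬ ProducesTrack s

data InitialLoss : BinStr → Set where
  il-one  : InitialLoss (false ∷ [])
  il-more : ∀ {s} → InitialLoss (false ∷ false ∷ s)

InitialLossNonTracking : BinStr → Set
InitialLossNonTracking s = InitialLoss s × NonTracking s

data Basic : BinStr → Set where
  b0     : Basic (false ∷ [])
  b001   : Basic (false ∷ false ∷ true ∷ [])
  b0011  : Basic (false ∷ false ∷ true ∷ true ∷ [])
  b00101 : Basic (false ∷ false ∷ true ∷ false ∷ true ∷ [])

-- A non-tracking string starting with 00 is cut after its longest prefix among 0, 001, 0011,
-- 00101: what remains is empty, 0, or starts again with 00, since every other continuation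
-- contains one of the tracks 111, 1101, 1011, 10101 (each of span at most 4 without a
-- double 0). Removing a prefix keeps a string non-tracking, so the cut can be repeated.
module Submission where

open import Defs
open import Data.Bool using (true; false)
open import Data.Nat using (suc; zero; _≤_; _<_; z<s; s<s)
open import Data.Nat.Properties using (≤-refl; m≤n+m; <⇒≤; <-trans; ≤-<-trans; n<1+n)
open import Data.List using ([]; _∷_; _++_; concat; length)
open import Data.List.Properties using (++-identityʳ)
open import Data.List.Relation.Unary.All using (All; []; _∷_)
open import Data.Product using (∃-syntax; _×_; _,_)
open import Data.Empty using (⊥-elim)
open import Relation.Binary.PropositionalEquality using (_≡_; refl; sym; trans; cong)

pattern T = true
pattern F = false

at-++ˡ : ∀ s r {n} → n < length s → at (s ++ r) n ≡ at s n
at-++ˡ (_ ∷ _) r {zero}  _           = refl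
at-++ˡ (_ ∷ s) r {suc n} (s<s n<∣s∣) = at-++ˡ s r n<∣s∣

at≡true⇒<length : ∀ s {n} → at s n ≡ true → n < length s
at≡true⇒<length (_ ∷ _) {zero}  _  = z<s
at≡true⇒<length (_ ∷ s) {suc n} sₙ = s<s (at≡true⇒<length s sₙ)

producesTrack-++⁺ˡ : ∀ {s} r → ProducesTrack s → ProducesTrack (s ++ r)
producesTrack-++⁺ˡ {s} r (i , j , l , i<j , j<l , sᵢ , sⱼ , sₗ , span , noLoss) =
  i , j , l , i<j , j<l ,
  agree (<⇒≤ (<-trans i<j j<l)) sᵢ , agree (<⇒≤ j<l) sⱼ , agree ≤-refl sₗ , span ,
  λ p i<p 1+p<l (sₚ , sₚ₊₁) →
    noLoss p i<p 1+p<l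
      (agree⁻ (<⇒≤ (<-trans (n<1+n p) 1+p<l)) sₚ , agree⁻ (<⇒≤ 1+p<l) sₚ₊₁)
  where
  agrees : ∀ {n} → n ≤ l → at (s ++ r) n ≡ at s n
  agrees n≤l = at-++ˡ s r (≤-<-trans n≤l (at≡true⇒<length s sₗ))

  agree : ∀ {n b} → n ≤ l → at s n ≡ b → at (s ++ r) n ≡ b
  agree n≤l = trans (agrees n≤l)

  agree⁻ : ∀ {n b} → n ≤ l → at (s ++ r) n ≡ b → at s n ≡ b
  agree⁻ n≤l = trans (sym (agrees n≤l))

producesTrack-∷ : ∀ {s} b → ProducesTrack s → ProducesTrack (b ∷ s)
producesTrack-∷ b (i , j , l , i<j , j<l , sᵢ , sⱼ , sₗ , span , noLoss) =
  suc i , suc j , suc l , s<s i<j , s<s j<l , sᵢ , sⱼ , sₗ , span , noLoss′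
  where
  noLoss′ : ∀ p → suc i < p → suc p < suc l → _
  noLoss′ (suc p) (s<s i<p) (s<s 1+p<l) = noLoss p i<p 1+p<l

producesTrack-++⁺ʳ : ∀ {s} xs → ProducesTrack s → ProducesTrack (xs ++ s)
producesTrack-++⁺ʳ []       t = t
producesTrack-++⁺ʳ (x ∷ xs) t = producesTrack-∷ x (producesTrack-++⁺ʳ xs t)

nonTracking-++⁻ʳ : ∀ {s} xs → NonTracking (xs ++ s) → NonTracking s
nonTracking-++⁻ʳ xs nt t = nt (producesTrack-++⁺ʳ xs t)

track-111 : ProducesTrack (T ∷ T ∷ T ∷ [])
track-111 = 0 , 1 , 2 , z<s , s<s z<s , refl , refl , refl , m≤n+m 2 2 ,
  λ { (suc (suc p)) _ (s<s (s<s ())) }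

track-1101 : ProducesTrack (T ∷ T ∷ F ∷ T ∷ [])
track-1101 = 0 , 1 , 3 , z<s , s<s z<s , refl , refl , refl , m≤n+m 3 1 ,
  λ { 1 _ _ (() , _) ; (suc (suc p)) _ (s<s (s<s (s<s ()))) }

track-1011 : ProducesTrack (T ∷ F ∷ T ∷ T ∷ [])
track-1011 = 0 , 2 , 3 , z<s , s<s (s<s z<s) , refl , refl , refl , m≤n+m 3 1 ,
  λ { 1 _ _ (_ , ()) ; (suc (suc p)) _ (s<s (s<s (s<s ()))) }

track-10101 : ProducesTrack (T ∷ F ∷ T ∷ F ∷ T ∷ [])
track-10101 = 0 , 2 , 4 , z<s , s<s (s<s z<s) , refl , refl , refl , ≤-refl ,
  λ { 1 _ _ (_ , ()) ; 2 _ _ (() , _) ; (suc (suc (suc p))) _ (s<s (s<s (s<s (s<s ())))) }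

producesTrack-infix : ∀ xs {w} r → ProducesTrack w → ProducesTrack (xs ++ w ++ r)
producesTrack-infix xs {w} r t = producesTrack-++⁺ʳ xs (producesTrack-++⁺ˡ {w} r t)

BasicConcat : BinStr → Set
BasicConcat s = ∃[ ws ] (All Basic ws × concat ws ≡ s)

basicConcat-singleton : ∀ {w} → Basic w → BasicConcat w
basicConcat-singleton {w} b = w ∷ [] , b ∷ [] , ++-identityʳ w

basicConcat-∷ : ∀ {w r} → Basic w → BasicConcat r → BasicConcat (w ++ r)
basicConcat-∷ {w} b (ws , basic , w≡r) = w ∷ ws , b ∷ basic , cong (w ++_) w≡r

decompose : ∀ s → InitialLoss s → NonTracking s → BasicConcat s
decompose (F ∷ []) il-one _ = basicConcat-singleton b0
decompose (F ∷ F ∷ []) il-more nt =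
  basicConcat-∷ b0 (decompose _ il-one (nonTracking-++⁻ʳ (F ∷ []) nt))
decompose (F ∷ F ∷ F ∷ r) il-more nt =
  basicConcat-∷ b0 (decompose _ il-more (nonTracking-++⁻ʳ (F ∷ []) nt))
decompose (F ∷ F ∷ T ∷ []) il-more _ = basicConcat-singleton b001
decompose (F ∷ F ∷ T ∷ F ∷ []) il-more nt =
  basicConcat-∷ b001 (decompose _ il-one (nonTracking-++⁻ʳ (F ∷ F ∷ T ∷ []) nt))
decompose (F ∷ F ∷ T ∷ F ∷ F ∷ r) il-more nt =
  basicConcat-∷ b001 (decompose _ il-more (nonTracking-++⁻ʳ (F ∷ F ∷ T ∷ []) nt))
decompose (F ∷ F ∷ T ∷ T ∷ []) il-more _ = basicConcat-singleton b0011
decompose (F ∷ F ∷ T ∷ T ∷ T ∷ r) il-more nt =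
  ⊥-elim (nt (producesTrack-infix (F ∷ F ∷ []) r track-111))
decompose (F ∷ F ∷ T ∷ T ∷ F ∷ []) il-more nt =
  basicConcat-∷ b0011 (decompose _ il-one (nonTracking-++⁻ʳ (F ∷ F ∷ T ∷ T ∷ []) nt))
decompose (F ∷ F ∷ T ∷ T ∷ F ∷ T ∷ r) il-more nt =
  ⊥-elim (nt (producesTrack-infix (F ∷ F ∷ []) r track-1101))
decompose (F ∷ F ∷ T ∷ T ∷ F ∷ F ∷ r) il-more nt =
  basicConcat-∷ b0011 (decompose _ il-more (nonTracking-++⁻ʳ (F ∷ F ∷ T ∷ T ∷ []) nt))
decompose (F ∷ F ∷ T ∷ F ∷ T ∷ []) il-more _ = basicConcat-singleton b00101
decompose (F ∷ F ∷ T ∷ F ∷ T ∷ T ∷ r) il-more nt =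
  ⊥-elim (nt (producesTrack-infix (F ∷ F ∷ []) r track-1011))
decompose (F ∷ F ∷ T ∷ F ∷ T ∷ F ∷ []) il-more nt =
  basicConcat-∷ b00101 (decompose _ il-one (nonTracking-++⁻ʳ (F ∷ F ∷ T ∷ F ∷ T ∷ []) nt))
decompose (F ∷ F ∷ T ∷ F ∷ T ∷ F ∷ T ∷ r) il-more nt =
  ⊥-elim (nt (producesTrack-infix (F ∷ F ∷ []) r track-10101))
decompose (F ∷ F ∷ T ∷ F ∷ T ∷ F ∷ F ∷ r) il-more nt =
  basicConcat-∷ b00101 (decompose _ il-more (nonTracking-++⁻ʳ (F ∷ F ∷ T ∷ F ∷ T ∷ []) nt))

lemma2 : (s : BinStr) → InitialLossNonTracking s →
    ∃[ ws ] (All Basic ws × concat ws ≡ s)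
lemma2 s (initialLoss , nonTracking) = decompose s initialLoss nonTracking
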